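{- Let ${\cal T}$ be a closed triangulated surface and $({\cal G},{\cal D},\{{\cal D}_1,\ldots,{\cal D}_n\})$ a decomposition of ${\cal T}$. Then the number of triangles of ${\cal D}$ is at least ${\rm mv}({\cal T})$ and the number of vertices of ${\cal D}$ is at least ${\rm mv}({\cal T})+1$.
   Context: A closed triangulated surface is a finite simplicial complex whose underlying space is a connected compact surface without boundary. The valence of a vertex is the number of triangles containing it; ${\rm mv}({\cal T})$ denotes the maximal valence of the vertices of ${\cal T}$. A decomposition of ${\cal T}$ is a triple $({\cal G},{\cal D},\{{\cal D}_1,\ldots,{\cal D}_n\})$, $n\geq 0$, where ${\cal G},{\cal D},{\cal D}_1,\ldots,{\cal D}_n$ are subcomplexes of ${\cal T}$, ${\cal D},{\cal D}_1,\ldots,{\cal D}_n$ are triangulated discs, the interior of ${\cal D}$ contains a vertex of ${\cal T}$ of valence ${\rm mv}({\cal T})$, ${\cal G}\cup{\cal D}\cup{\cal D}_1\cup\ldots\cup{\cal D}_n={\cal T}$, and the intersection of any two of these subcomplexes is either empty or a triangulated circle. ${\cal G}$ is the genus-surface and ${\cal D}$ the main disc. -}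

module Defs where

open import Data.Bool using (Bool; true; false; _∧_; not)
open import Data.Nat using (ℕ; zero; suc; _+_; _≤_; _≡ᵇ_; _<ᵇ_; _⊔_)
open import Data.Fin using (Fin)
open import Data.Fin.Subset using (Subset; ∣_∣; _∪_; ⁅_⁆; _⊆_; Nonempty; inside; outside)
open import Data.Vec using ([]; _∷_; lookup)
open import Data.List using (List; []; _∷_; _++_; map; filter; length; foldr; allFin)
open import Data.Product using (Σ; _×_; ∃)
open import Data.Sum using (_⊎_)
open import Relation.Binary.PropositionalEquality using (_≡_; _≢_)
open import Relation.Nullary.Decidable using (Dec)
open import Data.Bool.Properties using (T?)
open import Data.Bool using (T)

-- Abstract simplicial complexes on the vertex labels Fin N.
-- A complex is a decidable set of simplices (nonempty subsets of Fin N).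

Complex : ℕ → Set
Complex N = Subset N → Bool

allSubsets : ∀ n → List (Subset n)
allSubsets zero = [] ∷ []
allSubsets (suc n) = map (outside ∷_) (allSubsets n) ++ map (inside ∷_) (allSubsets n)

-- number of k-element simplices (i.e. (k-1)-simplices) of K
count : ∀ {N} → ℕ → Complex N → ℕ
count {N} k K = length (filter (λ s → T? (K s ∧ (∣ s ∣ ≡ᵇ k))) (allSubsets N))

numVertices numEdges numTriangles : ∀ {N} → Complex N → ℕ
numVertices = count 1
numEdges = count 2
numTriangles = count 3

record IsComplex {N} (K : Complex N) : Set where
  field
    nonempty : ∀ s → K s ≡ true → Nonempty s
    dim≤2    : ∀ s → K s ≡ true → ∣ s ∣ ≤ 3
    faces    : ∀ s t → K s ≡ true → t ⊆ s → Nonempty t → K t ≡ true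

IsVertex : ∀ {N} → Complex N → Fin N → Set
IsVertex K v = K ⁅ v ⁆ ≡ true

Adjacent : ∀ {N} → Complex N → Fin N → Fin N → Set
Adjacent K u w = (u ≢ w) × (K (⁅ u ⁆ ∪ ⁅ w ⁆) ≡ true)

data Walk {N} (K : Complex N) : Fin N → Fin N → Set where
  here : ∀ {u} → Walk K u u
  step : ∀ {u w v} → Adjacent K u w → Walk K w v → Walk K u v

Connected : ∀ {N} → Complex N → Set
Connected K = ∀ u v → IsVertex K u → IsVertex K v → Walk K u v

degree : ∀ {N} → Complex N → Fin N → ℕ
degree {N} K v = length (filter (λ s → T? (K s ∧ (∣ s ∣ ≡ᵇ 2) ∧ lookup s v)) (allSubsets N))

valence : ∀ {N} → Complex N → Fin N → ℕ
valence {N} K v = length (filter (λ s → T? (K s ∧ (∣ s ∣ ≡ᵇ 3) ∧ lookup s v)) (allSubsets N))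

mv : ∀ {N} → Complex N → ℕ
mv {N} K = foldr _⊔_ 0 (map (valence K) (allFin N))

link : ∀ {N} → Complex N → Fin N → Complex N
link K v s = not (lookup s v) ∧ (0 <ᵇ ∣ s ∣) ∧ K (⁅ v ⁆ ∪ s)

record IsCircle {N} (L : Complex N) : Set where
  field
    complex   : IsComplex L
    dim≤1     : ∀ s → L s ≡ true → ∣ s ∣ ≤ 2
    inhabited : ∃ λ v → IsVertex L v
    connected : Connected L
    deg2      : ∀ v → IsVertex L v → degree L v ≡ 2

record IsArc {N} (L : Complex N) : Set where
  field
    complex   : IsComplex L
    dim≤1     : ∀ s → L s ≡ true → ∣ s ∣ ≤ 2
    twoVerts  : 2 ≤ numVertices L
    connected : Connected L
    deg≤2     : ∀ v → IsVertex L v → degree L v ≤ 2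
    tree      : numEdges L + 1 ≡ numVertices L

record IsClosedSurface {N} (K : Complex N) : Set where
  field
    complex   : IsComplex K
    inhabited : ∃ λ v → IsVertex K v
    connected : Connected K
    links     : ∀ v → IsVertex K v → IsCircle (link K v)

-- Triangulated disc: a connected compact triangulated surface with boundary
-- (every vertex link a circle or an arc), with nonempty boundary (some link
-- is an arc) and Euler characteristic V - E + F = 1.
record IsDisc {N} (K : Complex N) : Set where
  field
    complex   : IsComplex K
    connected : Connected K
    links     : ∀ v → IsVertex K v → IsCircle (link K v) ⊎ IsArc (link K v)
    boundary  : ∃ λ v → IsVertex K v × IsArc (link K v)
    euler     : numVertices K + numTriangles K ≡ numEdges K + 1

InteriorVertex : ∀ {N} → Complex N → Fin N → Set
InteriorVertex K v = IsVertex K v × IsCircle (link K v)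

_⊑_ : ∀ {N} → Complex N → Complex N → Set
K ⊑ L = ∀ s → K s ≡ true → L s ≡ true

_∩ᶜ_ : ∀ {N} → Complex N → Complex N → Complex N
(K ∩ᶜ L) s = K s ∧ L s

IsEmpty : ∀ {N} → Complex N → Set
IsEmpty K = ∀ s → K s ≡ false

⋃ : ∀ {N m} → (Fin m → Complex N) → Complex N
⋃ {m = zero} F s = false
⋃ {m = suc m} F s = F Fin.zero s Data.Bool.∨ ⋃ (λ i → F (Fin.suc i)) s

-- Decomposition (G, D, {D₁,…,Dₙ}) of T.  The pieces are indexed by
-- Fin (2 + n): index 0 is G, index 1 is D, index 2+i is D_{i+1}.

pieces : ∀ {N n} → Complex N → Complex N → (Fin n → Complex N) → Fin (2 + n) → Complex N
pieces G D Ds Fin.zero = G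
pieces G D Ds (Fin.suc Fin.zero) = D
pieces G D Ds (Fin.suc (Fin.suc i)) = Ds i

record Decomposition {N} (T : Complex N) : Set where
  field
    n    : ℕ
    G    : Complex N
    D    : Complex N
    Ds   : Fin n → Complex N
    sub      : ∀ i → pieces G D Ds i ⊑ T
    G-complex : IsComplex G
    D-disc   : IsDisc D
    Ds-disc  : ∀ i → IsDisc (Ds i)
    centre   : ∃ λ v → InteriorVertex D v × valence T v ≡ mv T
    cover    : ∀ s → ⋃ (pieces G D Ds) s ≡ T s
    meet     : ∀ i j → i ≢ j →
               IsEmpty (pieces G D Ds i ∩ᶜ pieces G D Ds j)
               ⊎ IsCircle (pieces G D Ds i ∩ᶜ pieces G D Ds j)

-- Let v be the interior vertex of D of maximal valence.  Since D ⊆ T, the link of v in D is a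
-- triangulated circle inside the triangulated circle lk_T(v), and it contains every edge of lk_T(v):
-- at a common vertex both circles have exactly two edges, and connectedness spreads common vertices.
-- Triangles of T at v correspond to edges of lk_T(v), so mv(T) = val_T(v) ≤ #edges lk_D(v) = val_D(v),
-- at most the number of triangles of D.  By the handshake lemma a circle has as many edges as
-- vertices, and the vertices of lk_D(v) together with v are distinct vertices of D.

module Submission where

open import Defs
open import Data.Nat using (ℕ; _≤_; _+_)
open import Data.Product using (_×_)

open import Data.Bool using (Bool; true; false; _∧_; not)
open import Data.Bool.Properties using (T?; T-≡; ∧-assoc; ∧-zeroʳ; ∧-identityʳ; ∧-conicalˡ; ∧-conicalʳ)
open import Data.Fin using (Fin)
open import Data.Fin.Subset using (Subset; ∣_∣; _∪_; ⁅_⁆; ⊥; _∈_; _∉_; _⊆_; Nonempty; inside; outside)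
open import Data.Fin.Subset.Properties using (∪-identityˡ; x∈⁅x⁆; x∈⁅y⁆⇒x≡y; x≢y⇒x∉⁅y⁆; ∣⁅x⁆∣≡1; x∈p∪q⁺; q⊆p∪q)
open import Data.List using (List; []; _∷_; _++_; map; filter; length)
open import Data.List.Membership.Propositional using () renaming (_∈_ to _∈ˡ_)
open import Data.List.Membership.Propositional.Properties using (∈-map⁺; ∈-++⁺ˡ; ∈-++⁺ʳ; ∈-filter⁺; ∈-filter⁻)
open import Data.List.Properties using (length-++; filter-++; filter-none)
open import Data.List.Relation.Binary.Pointwise using (Pointwise-≡⇒≡)
open import Data.List.Relation.Binary.Sublist.Propositional using (⊆-refl) renaming (_⊆_ to _⊆ˢ_)
open import Data.List.Relation.Binary.Sublist.Propositional.Properties using (filter⁺; length-mono-≤; to-≋)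
open import Data.List.Relation.Unary.All using (tabulate)
open import Data.List.Relation.Unary.Any using () renaming (here to hereˡ)
open import Data.Nat using (zero; suc; _*_; _<_; _≡ᵇ_; _<ᵇ_)
open import Data.Nat.Properties using (+-*-semiring; +-comm; +-identityʳ; *-identityʳ; *-zeroʳ; *-distribˡ-+; *-cancelˡ-≡; ≡ᵇ⇒≡; ≤∧≢⇒<; +-monoˡ-≤; module ≤-Reasoning)
open import Algebra.Properties.Semiring.Sum +-*-semiring using (sum-syntax; sum-cong-≗; sum-replicate-zero; ∑-distrib-+; *-distribˡ-sum)
open import Data.Product using (_,_; proj₁; proj₂)
open import Data.Sum using (inj₁)
open import Data.Vec using ([]; _∷_; lookup; here; there)
open import Data.Vec.Properties using ([]=⇒lookup; lookup⇒[]=)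
open import Function using (_∘_; Equivalence)
open import Relation.Binary.PropositionalEquality using (_≡_; _≢_; refl; sym; trans; cong; cong₂; subst; module ≡-Reasoning)
open import Relation.Nullary using (contradiction)

open Equivalence using (to; from)

∧-false≢true : ∀ b → b ∧ false ≢ true
∧-false≢true b = subst (_≢ true) (sym (∧-zeroʳ b)) λ ()

𝟙 : Bool → ℕ
𝟙 true = 1
𝟙 false = 0

countᵇ : ∀ {A : Set} → (A → Bool) → List A → ℕ
countᵇ P xs = length (filter (λ x → T? (P x)) xs)

module _ {A : Set} where

  countᵇ-∷ : ∀ (P : A → Bool) x xs → countᵇ P (x ∷ xs) ≡ 𝟙 (P x) + countᵇ P xs
  countᵇ-∷ P x xs with P x
  ... | true = refl
  ... | false = refl

  countᵇ-cong : ∀ {P Q : A → Bool} → (∀ x → P x ≡ Q x) → ∀ xs → countᵇ P xs ≡ countᵇ Q xs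
  countᵇ-cong P≗Q [] = refl
  countᵇ-cong {P} {Q} P≗Q (x ∷ xs) = begin
    countᵇ P (x ∷ xs)        ≡⟨ countᵇ-∷ P x xs ⟩
    𝟙 (P x) + countᵇ P xs    ≡⟨ cong₂ _+_ (cong 𝟙 (P≗Q x)) (countᵇ-cong P≗Q xs) ⟩
    𝟙 (Q x) + countᵇ Q xs    ≡⟨ countᵇ-∷ Q x xs ⟨
    countᵇ Q (x ∷ xs)        ∎
    where open ≡-Reasoning

  countᵇ-none : ∀ (P : A → Bool) xs → (∀ x → P x ≢ true) → countᵇ P xs ≡ 0
  countᵇ-none P xs ¬P = cong length (filter-none (λ x → T? (P x)) {xs} (tabulate (λ {x} _ → ¬P x ∘ to T-≡)))

  countᵇ-++ : ∀ (P : A → Bool) xs ys → countᵇ P (xs ++ ys) ≡ countᵇ P xs + countᵇ P ys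
  countᵇ-++ P xs ys = trans (cong length (filter-++ (λ x → T? (P x)) xs ys)) (length-++ (filter (λ x → T? (P x)) xs))

  countᵇ-map : ∀ {B : Set} (P : B → Bool) (f : A → B) xs → countᵇ P (map f xs) ≡ countᵇ (P ∘ f) xs
  countᵇ-map P f [] = refl
  countᵇ-map P f (x ∷ xs) with P (f x)
  ... | true = cong suc (countᵇ-map P f xs)
  ... | false = countᵇ-map P f xs

  module _ {P Q : A → Bool} (P⇒Q : ∀ x → P x ≡ true → Q x ≡ true) (xs : List A) where

    private
      filter-⊆ : filter (λ x → T? (P x)) xs ⊆ˢ filter (λ x → T? (Q x)) xs
      filter-⊆ = filter⁺ (λ x → T? (P x)) (λ x → T? (Q x)) (λ { refl → from T-≡ ∘ P⇒Q _ ∘ to T-≡ }) (⊆-refl {x = xs})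

    countᵇ-mono : countᵇ P xs ≤ countᵇ Q xs
    countᵇ-mono = length-mono-≤ filter-⊆

    countᵇ-≡⇒ : countᵇ P xs ≡ countᵇ Q xs → ∀ {x} → x ∈ˡ xs → Q x ≡ true → P x ≡ true
    countᵇ-≡⇒ eq x∈xs Qx = to T-≡ (proj₂ (∈-filter⁻ (λ x → T? (P x)) {xs = xs} x∈P))
      where
      x∈P : _ ∈ˡ filter (λ x → T? (P x)) xs
      x∈P = subst (_ ∈ˡ_) (sym (Pointwise-≡⇒≡ (to-≋ eq filter-⊆))) (∈-filter⁺ (λ x → T? (Q x)) x∈xs (from T-≡ Qx))

    countᵇ-mono-< : ∀ {x} → x ∈ˡ xs → Q x ≡ true → P x ≢ true → countᵇ P xs < countᵇ Q xs
    countᵇ-mono-< x∈xs Qx ¬Px = ≤∧≢⇒< countᵇ-mono (λ eq → ¬Px (countᵇ-≡⇒ eq x∈xs Qx))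

∈-allSubsets : ∀ {n} (s : Subset n) → s ∈ˡ allSubsets n
∈-allSubsets [] = hereˡ refl
∈-allSubsets {suc n} (outside ∷ s) = ∈-++⁺ˡ (∈-map⁺ (outside ∷_) (∈-allSubsets s))
∈-allSubsets {suc n} (inside ∷ s) = ∈-++⁺ʳ (map (outside ∷_) (allSubsets n)) (∈-map⁺ (inside ∷_) (∈-allSubsets s))

-- count k K, degree K v and valence K v are, definitionally, # of a conjunction K s ∧ ….
#_ : ∀ {n} → (Subset n → Bool) → ℕ
#_ {n} P = countᵇ P (allSubsets n)

#-suc : ∀ {n} (P : Subset (suc n) → Bool) → # P ≡ # (λ s → P (outside ∷ s)) + # (λ s → P (inside ∷ s))
#-suc {n} P = trans (countᵇ-++ P (map (outside ∷_) (allSubsets n)) _)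
                    (cong₂ _+_ (countᵇ-map P (outside ∷_) (allSubsets n)) (countᵇ-map P (inside ∷_) (allSubsets n)))

#-containing : ∀ {n} (P : Subset n → Bool) v → # (λ s → P s ∧ lookup s v) ≡ # (λ e → not (lookup e v) ∧ P (⁅ v ⁆ ∪ e))
#-containing {suc n} P Fin.zero = begin
  # (λ s → P s ∧ lookup s Fin.zero)
    ≡⟨ #-suc (λ s → P s ∧ lookup s Fin.zero) ⟩
  # (λ s → P (outside ∷ s) ∧ false) + # (λ s → P (inside ∷ s) ∧ true)
    ≡⟨ +-comm (# (λ s → P (outside ∷ s) ∧ false)) _ ⟩
  # (λ s → P (inside ∷ s) ∧ true) + # (λ s → P (outside ∷ s) ∧ false)
    ≡⟨ cong₂ _+_ (countᵇ-cong (λ s → trans (∧-identityʳ _) (cong (λ e → P (inside ∷ e)) (sym (∪-identityˡ s)))) (allSubsets n))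
                 (trans (countᵇ-none _ (allSubsets n) (λ s → ∧-false≢true (P (outside ∷ s))))
                        (sym (countᵇ-none (λ _ → false) (allSubsets n) (λ _ ())))) ⟩
  # (λ s → P (inside ∷ (⊥ ∪ s))) + #_ {n} (λ _ → false)
    ≡⟨ #-suc (λ e → not (lookup e Fin.zero) ∧ P (⁅ Fin.zero ⁆ ∪ e)) ⟨
  # (λ e → not (lookup e Fin.zero) ∧ P (⁅ Fin.zero ⁆ ∪ e)) ∎
  where open ≡-Reasoning
#-containing {suc n} P (Fin.suc v) = begin
  # (λ s → P s ∧ lookup s (Fin.suc v))
    ≡⟨ #-suc (λ s → P s ∧ lookup s (Fin.suc v)) ⟩
  # (λ s → P (outside ∷ s) ∧ lookup s v) + # (λ s → P (inside ∷ s) ∧ lookup s v)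
    ≡⟨ cong₂ _+_ (#-containing (λ s → P (outside ∷ s)) v) (#-containing (λ s → P (inside ∷ s)) v) ⟩
  # (λ e → not (lookup e v) ∧ P (outside ∷ (⁅ v ⁆ ∪ e))) + # (λ e → not (lookup e v) ∧ P (inside ∷ (⁅ v ⁆ ∪ e)))
    ≡⟨ #-suc (λ e → not (lookup e (Fin.suc v)) ∧ P (⁅ Fin.suc v ⁆ ∪ e)) ⟨
  # (λ e → not (lookup e (Fin.suc v)) ∧ P (⁅ Fin.suc v ⁆ ∪ e)) ∎
  where open ≡-Reasoning

#-empty : ∀ {n} (P : Subset n → Bool) → # (λ s → P s ∧ (∣ s ∣ ≡ᵇ 0)) ≡ 𝟙 (P ⊥)
#-empty {zero} P = trans (countᵇ-∷ (λ s → P s ∧ (∣ s ∣ ≡ᵇ 0)) [] []) (trans (+-identityʳ (𝟙 (P [] ∧ true))) (cong 𝟙 (∧-identityʳ (P []))))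
#-empty {suc n} P = begin
  # (λ s → P s ∧ (∣ s ∣ ≡ᵇ 0))
    ≡⟨ #-suc (λ s → P s ∧ (∣ s ∣ ≡ᵇ 0)) ⟩
  # (λ s → P (outside ∷ s) ∧ (∣ s ∣ ≡ᵇ 0)) + # (λ s → P (inside ∷ s) ∧ false)
    ≡⟨ cong₂ _+_ (#-empty (λ s → P (outside ∷ s)))
                 (countᵇ-none _ (allSubsets n) (λ s → ∧-false≢true (P (inside ∷ s)))) ⟩
  𝟙 (P ⊥) + 0
    ≡⟨ +-identityʳ _ ⟩
  𝟙 (P ⊥) ∎
  where open ≡-Reasoning

#-singletons : ∀ {n} (P : Subset n → Bool) → # (λ s → P s ∧ (∣ s ∣ ≡ᵇ 1)) ≡ ∑[ u < n ] 𝟙 (P ⁅ u ⁆)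
#-singletons {zero} P = countᵇ-none (λ s → P s ∧ (∣ s ∣ ≡ᵇ 1)) (allSubsets 0) λ { [] → ∧-false≢true (P []) }
#-singletons {suc n} P = begin
  # (λ s → P s ∧ (∣ s ∣ ≡ᵇ 1))
    ≡⟨ #-suc (λ s → P s ∧ (∣ s ∣ ≡ᵇ 1)) ⟩
  # (λ s → P (outside ∷ s) ∧ (∣ s ∣ ≡ᵇ 1)) + # (λ s → P (inside ∷ s) ∧ (∣ s ∣ ≡ᵇ 0))
    ≡⟨ cong₂ _+_ (#-singletons (λ s → P (outside ∷ s))) (#-empty (λ s → P (inside ∷ s))) ⟩
  ∑[ u < n ] 𝟙 (P ⁅ Fin.suc u ⁆) + 𝟙 (P ⁅ Fin.zero ⁆)
    ≡⟨ +-comm (∑[ u < n ] 𝟙 (P ⁅ Fin.suc u ⁆)) _ ⟩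
  ∑[ u < suc n ] 𝟙 (P ⁅ u ⁆) ∎
  where open ≡-Reasoning

∑-𝟙-lookup : ∀ {n} (s : Subset n) → ∑[ u < n ] 𝟙 (lookup s u) ≡ ∣ s ∣
∑-𝟙-lookup [] = refl
∑-𝟙-lookup (inside ∷ s) = cong suc (∑-𝟙-lookup s)
∑-𝟙-lookup (outside ∷ s) = ∑-𝟙-lookup s

∑-𝟙-∧-lookup : ∀ {n} b (s : Subset n) → ∑[ u < n ] 𝟙 (b ∧ lookup s u) ≡ 𝟙 b * ∣ s ∣
∑-𝟙-∧-lookup true s = trans (∑-𝟙-lookup s) (sym (+-identityʳ _))
∑-𝟙-∧-lookup {n} false s = sum-replicate-zero n

∑-countᵇ-containing : ∀ {n k} (P : Subset n → Bool) → (∀ s → P s ≡ true → ∣ s ∣ ≡ k) → ∀ xs →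
                      ∑[ u < n ] countᵇ (λ s → P s ∧ lookup s u) xs ≡ k * countᵇ P xs
∑-countᵇ-containing {n} {k} P size [] = trans (sum-replicate-zero n) (sym (*-zeroʳ k))
∑-countᵇ-containing {n} {k} P size (x ∷ xs) = begin
  ∑[ u < n ] countᵇ (λ s → P s ∧ lookup s u) (x ∷ xs)
    ≡⟨ sum-cong-≗ (λ u → countᵇ-∷ (λ s → P s ∧ lookup s u) x xs) ⟩
  ∑[ u < n ] (𝟙 (P x ∧ lookup x u) + countᵇ (λ s → P s ∧ lookup s u) xs)
    ≡⟨ ∑-distrib-+ (λ u → 𝟙 (P x ∧ lookup x u)) (λ u → countᵇ (λ s → P s ∧ lookup s u) xs) ⟩
  ∑[ u < n ] 𝟙 (P x ∧ lookup x u) + ∑[ u < n ] countᵇ (λ s → P s ∧ lookup s u) xs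
    ≡⟨ cong₂ _+_ (∑-𝟙-∧-lookup (P x) x) (∑-countᵇ-containing P size xs) ⟩
  𝟙 (P x) * ∣ x ∣ + k * countᵇ P xs
    ≡⟨ cong (_+ k * countᵇ P xs) weight ⟩
  k * 𝟙 (P x) + k * countᵇ P xs
    ≡⟨ *-distribˡ-+ k (𝟙 (P x)) (countᵇ P xs) ⟨
  k * (𝟙 (P x) + countᵇ P xs)
    ≡⟨ cong (k *_) (countᵇ-∷ P x xs) ⟨
  k * countᵇ P (x ∷ xs) ∎
  where
  open ≡-Reasoning
  weight : 𝟙 (P x) * ∣ x ∣ ≡ k * 𝟙 (P x)
  weight with P x in Px
  ... | true = trans (+-identityʳ ∣ x ∣) (trans (size x Px) (sym (*-identityʳ k)))
  ... | false = sym (*-zeroʳ k)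

x∈p⇒⁅x⁆⊆p : ∀ {n} {x : Fin n} {p} → x ∈ p → ⁅ x ⁆ ⊆ p
x∈p⇒⁅x⁆⊆p {x = x} x∈p y∈⁅x⁆ = subst (_∈ _) (sym (x∈⁅y⁆⇒x≡y x y∈⁅x⁆)) x∈p

∣⁅x⁆∪p∣≡1+∣p∣ : ∀ {n} (x : Fin n) (p : Subset n) → x ∉ p → ∣ ⁅ x ⁆ ∪ p ∣ ≡ suc ∣ p ∣
∣⁅x⁆∪p∣≡1+∣p∣ Fin.zero (inside ∷ p) x∉p = contradiction here x∉p
∣⁅x⁆∪p∣≡1+∣p∣ Fin.zero (outside ∷ p) _ = cong (suc ∘ ∣_∣) (∪-identityˡ p)
∣⁅x⁆∪p∣≡1+∣p∣ (Fin.suc x) (inside ∷ p) x∉p = cong suc (∣⁅x⁆∪p∣≡1+∣p∣ x p (x∉p ∘ there))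
∣⁅x⁆∪p∣≡1+∣p∣ (Fin.suc x) (outside ∷ p) x∉p = ∣⁅x⁆∪p∣≡1+∣p∣ x p (x∉p ∘ there)

∣⁅x⁆∪⁅y⁆∣≡2 : ∀ {n} {x y : Fin n} → x ≢ y → ∣ ⁅ x ⁆ ∪ ⁅ y ⁆ ∣ ≡ 2
∣⁅x⁆∪⁅y⁆∣≡2 {x = x} {y} x≢y = trans (∣⁅x⁆∪p∣≡1+∣p∣ x ⁅ y ⁆ (x≢y⇒x∉⁅y⁆ x≢y)) (cong suc (∣⁅x⁆∣≡1 y))

0<∣p∣⇒Nonempty : ∀ {n} (p : Subset n) → (0 <ᵇ ∣ p ∣) ≡ true → Nonempty p
0<∣p∣⇒Nonempty (inside ∷ p) _ = Fin.zero , here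
0<∣p∣⇒Nonempty (outside ∷ p) 0<∣p∣ = let x , x∈p = 0<∣p∣⇒Nonempty p 0<∣p∣ in Fin.suc x , there x∈p

lookup≡false⇒∉ : ∀ {n} {x : Fin n} {p} → lookup p x ≡ false → x ∉ p
lookup≡false⇒∉ p[x]≡false x∈p = contradiction (trans (sym ([]=⇒lookup x∈p)) p[x]≡false) λ ()

valence≡numEdges-link : ∀ {N} (K : Complex N) v → valence K v ≡ numEdges (link K v)
valence≡numEdges-link {N} K v = begin
  valence K v
    ≡⟨ countᵇ-cong (λ s → sym (∧-assoc (K s) _ _)) (allSubsets N) ⟩
  # (λ s → (K s ∧ (∣ s ∣ ≡ᵇ 3)) ∧ lookup s v)
    ≡⟨ #-containing (λ s → K s ∧ (∣ s ∣ ≡ᵇ 3)) v ⟩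
  # (λ e → not (lookup e v) ∧ (K (⁅ v ⁆ ∪ e) ∧ (∣ ⁅ v ⁆ ∪ e ∣ ≡ᵇ 3)))
    ≡⟨ countᵇ-cong star≡edge (allSubsets N) ⟩
  numEdges (link K v) ∎
  where
  open ≡-Reasoning
  shift : ∀ b m → b ∧ (suc m ≡ᵇ 3) ≡ ((0 <ᵇ m) ∧ b) ∧ (m ≡ᵇ 2)
  shift b zero = ∧-zeroʳ b
  shift b (suc m) = refl
  star≡edge : ∀ e → not (lookup e v) ∧ (K (⁅ v ⁆ ∪ e) ∧ (∣ ⁅ v ⁆ ∪ e ∣ ≡ᵇ 3)) ≡ link K v e ∧ (∣ e ∣ ≡ᵇ 2)
  star≡edge e with lookup e v in e[v]
  ... | true = refl
  ... | false rewrite ∣⁅x⁆∪p∣≡1+∣p∣ v e (lookup≡false⇒∉ e[v]) = shift (K (⁅ v ⁆ ∪ e)) ∣ e ∣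

valence≤numTriangles : ∀ {N} (K : Complex N) v → valence K v ≤ numTriangles K
valence≤numTriangles {N} K v = countᵇ-mono triangle (allSubsets N)
  where
  triangle : ∀ s → K s ∧ (∣ s ∣ ≡ᵇ 3) ∧ lookup s v ≡ true → K s ∧ (∣ s ∣ ≡ᵇ 3) ≡ true
  triangle s h = cong₂ _∧_ (∧-conicalˡ (K s) _ h) (∧-conicalˡ (∣ s ∣ ≡ᵇ 3) _ (∧-conicalʳ (K s) _ h))

handshake : ∀ {N} (K : Complex N) → ∑[ u < N ] degree K u ≡ 2 * numEdges K
handshake {N} K = begin
  ∑[ u < N ] degree K u
    ≡⟨ sum-cong-≗ (λ u → countᵇ-cong (λ s → sym (∧-assoc (K s) (∣ s ∣ ≡ᵇ 2) (lookup s u))) (allSubsets N)) ⟩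
  ∑[ u < N ] # (λ s → (K s ∧ (∣ s ∣ ≡ᵇ 2)) ∧ lookup s u)
    ≡⟨ ∑-countᵇ-containing (λ s → K s ∧ (∣ s ∣ ≡ᵇ 2)) edge-size (allSubsets N) ⟩
  2 * numEdges K ∎
  where
  open ≡-Reasoning
  edge-size : ∀ s → K s ∧ (∣ s ∣ ≡ᵇ 2) ≡ true → ∣ s ∣ ≡ 2
  edge-size s h = ≡ᵇ⇒≡ ∣ s ∣ 2 (from T-≡ (∧-conicalʳ (K s) _ h))

module _ {N} {K : Complex N} (K-complex : IsComplex K) (deg2 : ∀ v → IsVertex K v → degree K v ≡ 2) where

  degree≡2*𝟙[vertex] : ∀ u → degree K u ≡ 2 * 𝟙 (K ⁅ u ⁆)
  degree≡2*𝟙[vertex] u with K ⁅ u ⁆ in u∈K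
  ... | true = deg2 u u∈K
  ... | false = countᵇ-none _ (allSubsets N) no-edge
    where
    no-edge : ∀ s → K s ∧ (∣ s ∣ ≡ᵇ 2) ∧ lookup s u ≢ true
    no-edge s h = contradiction (trans (sym u∈K) u-vertex) λ ()
      where
      u-vertex : K ⁅ u ⁆ ≡ true
      u-vertex = IsComplex.faces K-complex s ⁅ u ⁆ (∧-conicalˡ (K s) _ h)
                   (x∈p⇒⁅x⁆⊆p (lookup⇒[]= u s (∧-conicalʳ (∣ s ∣ ≡ᵇ 2) _ (∧-conicalʳ (K s) _ h)))) (u , x∈⁅x⁆ u)

  2-regular⇒numEdges≡numVertices : numEdges K ≡ numVertices K
  2-regular⇒numEdges≡numVertices = *-cancelˡ-≡ _ _ 2 (begin
    2 * numEdges K                  ≡⟨ handshake K ⟨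
    ∑[ u < N ] degree K u           ≡⟨ sum-cong-≗ degree≡2*𝟙[vertex] ⟩
    ∑[ u < N ] (2 * 𝟙 (K ⁅ u ⁆))    ≡⟨ *-distribˡ-sum 2 (λ u → 𝟙 (K ⁅ u ⁆)) ⟨
    2 * ∑[ u < N ] 𝟙 (K ⁅ u ⁆)      ≡⟨ cong (2 *_) (#-singletons K) ⟨
    2 * numVertices K               ∎)
    where open ≡-Reasoning

circle⊑circle⇒edges-⊒ : ∀ {N} {L₁ L₂ : Complex N} → IsCircle L₁ → IsCircle L₂ → L₁ ⊑ L₂ →
                        ∀ e → L₂ e ≡ true → ∣ e ∣ ≡ 2 → L₁ e ≡ true
circle⊑circle⇒edges-⊒ {N} {L₁} {L₂} C₁ C₂ L₁⊑L₂ e e∈L₂ ∣e∣≡2 =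
  let x , x∈e = IsComplex.nonempty (complex C₂) e e∈L₂
  in edge-through-vertex e∈L₂ ∣e∣≡2 x∈e (vertex-of-L₁ (IsComplex.faces (complex C₂) e ⁅ x ⁆ e∈L₂ (x∈p⇒⁅x⁆⊆p x∈e) (x , x∈⁅x⁆ x)))
  where
  open IsCircle

  edge-through-vertex : ∀ {x e} → L₂ e ≡ true → ∣ e ∣ ≡ 2 → x ∈ e → IsVertex L₁ x → L₁ e ≡ true
  edge-through-vertex {x} {e} e∈L₂ ∣e∣≡2 x∈e x∈L₁ =
    ∧-conicalˡ (L₁ e) _ (countᵇ-≡⇒ edge⇒edge (allSubsets N) same-degree (∈-allSubsets e) e∋x)
    where
    edge⇒edge : ∀ s → L₁ s ∧ (∣ s ∣ ≡ᵇ 2) ∧ lookup s x ≡ true → L₂ s ∧ (∣ s ∣ ≡ᵇ 2) ∧ lookup s x ≡ true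
    edge⇒edge s h = cong₂ _∧_ (L₁⊑L₂ s (∧-conicalˡ (L₁ s) _ h)) (∧-conicalʳ (L₁ s) _ h)
    same-degree : degree L₁ x ≡ degree L₂ x
    same-degree = trans (deg2 C₁ x x∈L₁) (sym (deg2 C₂ x (L₁⊑L₂ _ x∈L₁)))
    e∋x : L₂ e ∧ (∣ e ∣ ≡ᵇ 2) ∧ lookup e x ≡ true
    e∋x = cong₂ _∧_ e∈L₂ (cong₂ _∧_ (cong (_≡ᵇ 2) ∣e∣≡2) ([]=⇒lookup x∈e))

  along : ∀ {u w} → Walk L₂ u w → IsVertex L₁ u → IsVertex L₁ w
  along here u∈L₁ = u∈L₁
  along (step {u} {y} (u≢y , uy∈L₂) walk) u∈L₁ = along walk y∈L₁
    where
    uy∈L₁ : L₁ (⁅ u ⁆ ∪ ⁅ y ⁆) ≡ true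
    uy∈L₁ = edge-through-vertex uy∈L₂ (∣⁅x⁆∪⁅y⁆∣≡2 u≢y) (x∈p∪q⁺ (inj₁ (x∈⁅x⁆ u))) u∈L₁
    y∈L₁ : IsVertex L₁ y
    y∈L₁ = IsComplex.faces (complex C₁) _ ⁅ y ⁆ uy∈L₁ (q⊆p∪q ⁅ u ⁆ ⁅ y ⁆) (y , x∈⁅x⁆ y)

  vertex-of-L₁ : ∀ {w} → IsVertex L₂ w → IsVertex L₁ w
  vertex-of-L₁ {w} w∈L₂ = let u , u∈L₁ = inhabited C₁ in along (connected C₂ u w (L₁⊑L₂ _ u∈L₁) w∈L₂) u∈L₁

link-mono : ∀ {N} {K L : Complex N} v → K ⊑ L → link K v ⊑ link L v
link-mono v K⊑L s h =
  cong₂ _∧_ (∧-conicalˡ (not (lookup s v)) _ h)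
            (cong₂ _∧_ (∧-conicalˡ (0 <ᵇ ∣ s ∣) _ h′) (K⊑L _ (∧-conicalʳ (0 <ᵇ ∣ s ∣) _ h′)))
  where h′ = ∧-conicalʳ (not (lookup s v)) _ h

link⊑ : ∀ {N} {K : Complex N} → IsComplex K → ∀ v → link K v ⊑ K
link⊑ K-complex v s h =
  IsComplex.faces K-complex (⁅ v ⁆ ∪ s) s (∧-conicalʳ (0 <ᵇ ∣ s ∣) _ h′) (q⊆p∪q ⁅ v ⁆ s)
    (0<∣p∣⇒Nonempty s (∧-conicalˡ (0 <ᵇ ∣ s ∣) _ h′))
  where h′ = ∧-conicalʳ (not (lookup s v)) _ h

numVertices-link< : ∀ {N} {K : Complex N} → IsComplex K → ∀ {v} → IsVertex K v → numVertices (link K v) < numVertices K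
numVertices-link< {N} {K} K-complex {v} v∈K =
  countᵇ-mono-< vertex⇒vertex (allSubsets N) (∈-allSubsets ⁅ v ⁆) (cong₂ _∧_ v∈K (cong (_≡ᵇ 1) (∣⁅x⁆∣≡1 v))) v∉link
  where
  vertex⇒vertex : ∀ s → link K v s ∧ (∣ s ∣ ≡ᵇ 1) ≡ true → K s ∧ (∣ s ∣ ≡ᵇ 1) ≡ true
  vertex⇒vertex s h = cong₂ _∧_ (link⊑ K-complex v s (∧-conicalˡ (link K v s) _ h)) (∧-conicalʳ (link K v s) _ h)
  v∉link : link K v ⁅ v ⁆ ∧ (∣ ⁅ v ⁆ ∣ ≡ᵇ 1) ≢ true
  v∉link h = contradiction (∧-conicalˡ (not (lookup ⁅ v ⁆ v)) _ (∧-conicalˡ (link K v ⁅ v ⁆) _ h))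
               (subst (λ b → not b ≢ true) (sym ([]=⇒lookup (x∈⁅x⁆ v))) λ ())

interior-vertex-bounds : ∀ {N} {T D : Complex N} {v} → IsComplex D → D ⊑ T → IsCircle (link T v) → InteriorVertex D v →
                         (valence T v ≤ numTriangles D) × (valence T v + 1 ≤ numVertices D)
interior-vertex-bounds {N} {T} {D} {v} D-complex D⊑T T-link (v∈D , D-link) = triangles , vertices
  where
  open ≤-Reasoning
  edges⊒ : ∀ s → link T v s ∧ (∣ s ∣ ≡ᵇ 2) ≡ true → link D v s ∧ (∣ s ∣ ≡ᵇ 2) ≡ true
  edges⊒ s h = cong₂ _∧_ (circle⊑circle⇒edges-⊒ D-link T-link (link-mono v D⊑T) s (∧-conicalˡ (link T v s) _ h)
                            (≡ᵇ⇒≡ ∣ s ∣ 2 (from T-≡ (∧-conicalʳ (link T v s) _ h))))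
                         (∧-conicalʳ (link T v s) _ h)
  valence≤edges : valence T v ≤ numEdges (link D v)
  valence≤edges = begin
    valence T v           ≡⟨ valence≡numEdges-link T v ⟩
    numEdges (link T v)   ≤⟨ countᵇ-mono edges⊒ (allSubsets N) ⟩
    numEdges (link D v)   ∎
  triangles : valence T v ≤ numTriangles D
  triangles = begin
    valence T v           ≤⟨ valence≤edges ⟩
    numEdges (link D v)   ≡⟨ valence≡numEdges-link D v ⟨
    valence D v           ≤⟨ valence≤numTriangles D v ⟩
    numTriangles D        ∎
  vertices : valence T v + 1 ≤ numVertices D
  vertices = begin
    valence T v + 1                 ≤⟨ +-monoˡ-≤ 1 valence≤edges ⟩
    numEdges (link D v) + 1         ≡⟨ cong (_+ 1) (2-regular⇒numEdges≡numVertices (IsCircle.complex D-link) (IsCircle.deg2 D-link)) ⟩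
    numVertices (link D v) + 1      ≡⟨ +-comm (numVertices (link D v)) 1 ⟩
    suc (numVertices (link D v))    ≤⟨ numVertices-link< D-complex v∈D ⟩
    numVertices D                   ∎

proposition2p8 : ∀ {N} (T : Complex N) → IsClosedSurface T → (dec : Decomposition T) → (mv T ≤ numTriangles (Decomposition.D dec)) × (mv T + 1 ≤ numVertices (Decomposition.D dec))
proposition2p8 T surface dec with Decomposition.centre dec
... | v , interior , valence≡mv rewrite sym valence≡mv =
  interior-vertex-bounds (IsDisc.complex D-disc) D⊑T (IsClosedSurface.links surface v (D⊑T _ (proj₁ interior))) interior
  where
  open Decomposition dec
  D⊑T : D ⊑ T
  D⊑T = sub (Fin.suc Fin.zero)
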